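{- Let $n\ge2$ and $m\ge1$. The number of dominant regions of the $m$-Shi arrangement in $V$ which have $H_{\theta,m}=H_{\alpha_{1,n-1},m}$ as a separating wall is $m^{n-2}$.
   Context: Let $e_1,\dots,e_n$ be the standard basis of $\mathbb R^n$ with the standard inner product $\langle\cdot,\cdot\rangle$, and $V=\{(a_1,\dots,a_n)\in\mathbb R^n:\sum_i a_i=0\}$. For $1\le i\le j\le n-1$ let $\alpha_{ij}=e_i-e_{j+1}$, $\alpha_i=\alpha_{ii}$, $\Delta^+=\{\alpha_{ij}\}$, $\theta=\alpha_{1,n-1}$. For $\alpha\in\Delta^+$, $k\in\mathbb Z$, let $H_{\alpha,k}=\{v\in V:\langle v,\alpha\rangle=k\}$. The $m$-Shi arrangement is $\{H_{\alpha,k}:\alpha\in\Delta^+,\,-m<k\le m\}$; its regions are the connected components of the complement of the union of its hyperplanes, and a region is dominant if it lies in $\{v\in V:\langle v,\alpha_i\rangle\ge0\ \forall i\}$. The fundamental alcove $A_0$ is the interior of $\{v\in V:\langle v,\theta\rangle\le1,\ \langle v,\alpha_i\rangle\ge0\ \forall i\}$. A wall of a region $R$ is a hyperplane of the $m$-Shi arrangement supporting a facet of $R$; it is a separating wall if $R$ and $A_0$ lie in different closed half-spaces determined by it.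
   Formalization: Points of V, including those that determine regions, walls and the fundamental alcove $A_0$, have rational rather than real coordinates. -}

module Defs where

open import Data.Nat as ℕ using (ℕ; zero; suc)
open import Data.Fin as Fin using (Fin; toℕ)
open import Data.Integer as ℤ using (ℤ; +_)
open import Data.Rational as ℚ using (ℚ; 0ℚ; 1ℚ; _/_)
open import Data.Product using (Σ; _×_; ∃)
open import Data.Sum using (_⊎_)
open import Data.List using (List; length)
open import Data.List.Relation.Unary.All using (All)
open import Data.List.Relation.Unary.Any using (Any)
open import Data.List.Relation.Unary.AllPairs using (AllPairs)
open import Relation.Nullary using (¬_)
open import Relation.Binary.PropositionalEquality using (_≡_; _≢_)
open import Function.Bundles using (_⇔_)

-- Points of ℝⁿ are modelled by rational points  Fin n → ℚ  (coordinates a_1..a_n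
-- are indexed by Fin n, i.e. e_i ↦ index i-1).  Every region of a rational
-- hyperplane arrangement is open, hence contains rational points, so regions are
-- faithfully represented by the rational points they contain.
Pt : ℕ → Set
Pt n = Fin n → ℚ

sumℚ : ∀ {n} → Pt n → ℚ
sumℚ {zero}  v = 0ℚ
sumℚ {suc n} v = v Fin.zero ℚ.+ sumℚ {n} (λ i → v (Fin.suc i))

InV : ∀ {n} → Pt n → Set
InV v = sumℚ v ≡ 0ℚ

⟦_⟧ : ℤ → ℚ
⟦ k ⟧ = k / 1

pair : ∀ {n} → Pt n → Fin n → Fin n → ℚ
pair v a b = v a ℚ.- v b

-- (a , b , k) with a < b indexes the hyperplane H_{e_a - e_b , k}; the positive
-- roots α_{ij} = e_i - e_{j+1} (1 ≤ i ≤ j ≤ n-1) are exactly e_a - e_b with a < b.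
ShiHyp : ∀ {n} → ℕ → Fin n → Fin n → ℤ → Set
ShiHyp m a b k = (a Fin.< b) × (ℤ.- (+ m) ℤ.< k) × (k ℤ.≤ + m)

OffArr : ∀ {n} → ℕ → Pt n → Set
OffArr {n} m v = ∀ (a b : Fin n) (k : ℤ) → ShiHyp m a b k → pair v a b ≢ ⟦ k ⟧

-- For points off the arrangement this is exactly "v and w lie in the same region"
-- (regions are the nonempty cells cut out by the hyperplanes, which are convex).
SameRegion : ∀ {n} → ℕ → Pt n → Pt n → Set
SameRegion {n} m v w = ∀ (a b : Fin n) (k : ℤ) → ShiHyp m a b k →
  (pair v a b ℚ.< ⟦ k ⟧) ⇔ (pair w a b ℚ.< ⟦ k ⟧)

-- The region containing v is dominant: it lies in {⟨x,α_i⟩ ≥ 0 for all i},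
-- α_i = e_i - e_{i+1}.  (The region lies on one side of each H_{α_i,0}, so this
-- holds for the whole region iff it holds for the point v.)
Dominant : ∀ {n} → Pt n → Set
Dominant {n} v = ∀ (i j : Fin n) → toℕ j ≡ suc (toℕ i) → v j ℚ.≤ v i

-- H_{e_a-e_b,k} is a wall of the region containing v: it is a hyperplane of the
-- arrangement and supports a facet of the closure of the region, i.e. some point p
-- of V on this hyperplane lies on no other hyperplane of the arrangement and lies
-- on the same side as v of every other hyperplane (so a neighbourhood of p in the
-- hyperplane is contained in the closure of the region).
IsWall : ∀ {n} → ℕ → Pt n → Fin n → Fin n → ℤ → Set
IsWall {n} m v a b k = ShiHyp m a b k × ∃ λ (p : Pt n) → InV p × (pair p a b ≡ ⟦ k ⟧) ×
  (∀ (a' b' : Fin n) (k' : ℤ) → ShiHyp m a' b' k' → ¬ (a' ≡ a × b' ≡ b × k' ≡ k) →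
     (pair p a' b' ≢ ⟦ k' ⟧) × ((pair p a' b' ℚ.< ⟦ k' ⟧) ⇔ (pair v a' b' ℚ.< ⟦ k' ⟧)))

-- x lies in the fundamental alcove A_0 (the open alcove); a0 , b0 are the indices
-- with θ = e_{a0} - e_{b0}
InA0 : ∀ {n} → Fin n → Fin n → Pt n → Set
InA0 {n} a0 b0 x = InV x × (pair x a0 b0 ℚ.< 1ℚ) ×
  (∀ (i j : Fin n) → toℕ j ≡ suc (toℕ i) → x j ℚ.< x i)

Separates : ∀ {n} → Fin n → Fin n → Pt n → Fin n → Fin n → ℤ → Set
Separates {n} a0 b0 v a b k = ∀ (x : Pt n) → InA0 a0 b0 x →
  ((pair x a b ℚ.< ⟦ k ⟧) × (⟦ k ⟧ ℚ.< pair v a b)) ⊎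
  ((⟦ k ⟧ ℚ.< pair x a b) × (pair v a b ℚ.< ⟦ k ⟧))

Qualifies : ∀ {n} → ℕ → Fin n → Fin n → Pt n → Set
Qualifies m a0 b0 v = InV v × OffArr m v × Dominant v ×
  IsWall m v a0 b0 (+ m) × Separates a0 b0 v a0 b0 (+ m)

-- The number of regions (equivalence classes of qualifying points under
-- SameRegion) equals N: there is a list of N pairwise-distinct regions
-- (representatives) that contains every qualifying region.
NumRegions≡ : ∀ {n} → ℕ → Fin n → Fin n → ℕ → Set
NumRegions≡ {n} m a0 b0 N = Σ (List (Pt n)) λ L →
  (length L ≡ N) × All (Qualifies m a0 b0) L ×
  AllPairs (λ v w → ¬ SameRegion m v w) L ×
  (∀ (v : Pt n) → Qualifies m a0 b0 v → Any (SameRegion m v) L)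

-- A dominant region R having H_{θ,m} as a separating wall has a facet on H_{θ,m}; a point p of that
-- facet has strictly decreasing coordinates, and the heights h_i = p_0 - p_i of its n - 2 middle
-- coordinates are non-integers in (0, m) with pairwise distinct fractional parts.  The position of R
-- with respect to every hyperplane of the arrangement is read off from the floors of the h_i and the
-- order of their fractional parts, i.e. from the function Fin (n - 2) → Fin m sending r to the floor of
-- the h_i with the r-th smallest fractional part.  Conversely each such function is realised by an
-- explicit rational point, and different functions give regions separated by some hyperplane, so there
-- are exactly m ^ (n - 2) regions.

module Submission where

open import Defs
open import Data.Nat using (ℕ; _≤_; _∸_; _^_)
open import Data.Fin using (Fin; toℕ)
open import Relation.Binary.PropositionalEquality using (_≡_)

open import Data.Nat as ℕ using (zero; suc; z≤n; s≤s)
import Data.Nat.Properties as ℕ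
open import Data.Nat.Solver using (module +-*-Solver)
import Data.Fin as Fin
import Data.Fin.Properties as Fin
open import Data.Integer as ℤ using (ℤ; +_)
import Data.Integer.Properties as ℤ
import Data.Integer.Solver as ℤ-Solver
open import Data.Rational as ℚ using (ℚ; 0ℚ; 1ℚ; _/_)
import Data.Rational.Properties as ℚ
import Data.Rational.Solver as ℚ-Solver
open import Data.Rational.Unnormalised as ℚᵘ using (mkℚᵘ; *≡*; *<*)
import Data.Rational.Unnormalised.Properties as ℚᵘ
open import Data.Product using (Σ; ∃; _×_; _,_; proj₁; proj₂)
open import Data.Product.Relation.Binary.Lex.Strict using (×-Lex; ×-compare; ×-decidable; ×-irreflexive; ×-transitive)
open import Data.Sum using (_⊎_; inj₁; inj₂; [_,_]′)
open import Data.Empty using (⊥-elim)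
import Data.List as List
import Data.List.Properties as List
import Data.List.Relation.Unary.All.Properties as All
import Data.List.Relation.Unary.Any.Properties as Any
import Data.List.Relation.Unary.AllPairs.Properties as AllPairs
open import Function using (_∘_; id)
open import Function.Bundles using (_⇔_; mk⇔; Equivalence)
open import Function.Properties.Equivalence using () renaming (sym to ⇔-sym; trans to ⇔-trans)
open import Relation.Nullary using (¬_; Dec; yes; no)
open import Relation.Binary.Definitions using (Tri; tri<; tri≈; tri>)
open import Relation.Binary.PropositionalEquality
  using (_≢_; refl; sym; trans; cong; cong₂; subst; subst₂; isEquivalence; module ≡-Reasoning)

-- Rationals with denominator 1 + N

infixl 7 _/1+_

-- Opaque: unfolding _/_ would make type checking normalise its gcd computation.
opaque
  _/1+_ : ℤ → ℕ → ℚ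
  a /1+ N = a / suc N

  ⟦⟧≡/1+0 : ∀ k → ⟦ k ⟧ ≡ k /1+ 0
  ⟦⟧≡/1+0 k = refl

  toℚᵘ-/1+ : ∀ a N → ℚ.toℚᵘ (a /1+ N) ℚᵘ.≃ mkℚᵘ a N
  toℚᵘ-/1+ a N = ℚ.toℚᵘ-fromℚᵘ (mkℚᵘ a N)

/1+-cong : ∀ {a b} N M → a ℤ.* + suc M ≡ b ℤ.* + suc N → a /1+ N ≡ b /1+ M
/1+-cong {a} {b} N M eq = ℚ.toℚᵘ-injective
  (ℚᵘ.≃-trans (toℚᵘ-/1+ a N) (ℚᵘ.≃-trans (*≡* eq) (ℚᵘ.≃-sym (toℚᵘ-/1+ b M))))

/1+-homo-+ : ∀ N a b → (a ℤ.+ b) /1+ N ≡ a /1+ N ℚ.+ b /1+ N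
/1+-homo-+ N a b = ℚ.toℚᵘ-injective (ℚᵘ.≃-trans (toℚᵘ-/1+ (a ℤ.+ b) N) (ℚᵘ.≃-trans (*≡* eq)
  (ℚᵘ.≃-sym (ℚᵘ.≃-trans (ℚ.toℚᵘ-homo-+ (a /1+ N) (b /1+ N))
                         (ℚᵘ.+-cong (toℚᵘ-/1+ a N) (toℚᵘ-/1+ b N))))))
  where
  open ℤ-Solver.+-*-Solver using (solve; _:+_; _:-_; _:*_; _:=_; con)
  eq : (a ℤ.+ b) ℤ.* (+ suc N ℤ.* + suc N) ≡ (a ℤ.* + suc N ℤ.+ b ℤ.* + suc N) ℤ.* + suc N
  eq = solve 3 (λ a b d → (a :+ b) :* (d :* d) := (a :* d :+ b :* d) :* d) refl a b (+ suc N)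

/1+-homo-neg : ∀ N a → (ℤ.- a) /1+ N ≡ ℚ.- (a /1+ N)
/1+-homo-neg N a = ℚ.toℚᵘ-injective (ℚᵘ.≃-trans (toℚᵘ-/1+ (ℤ.- a) N)
  (ℚᵘ.≃-sym (ℚᵘ.≃-trans (ℚ.toℚᵘ-homo‿- (a /1+ N)) (ℚᵘ.-‿cong (toℚᵘ-/1+ a N)))))

/1+-homo-sub : ∀ N a b → (a ℤ.- b) /1+ N ≡ a /1+ N ℚ.- b /1+ N
/1+-homo-sub N a b = trans (/1+-homo-+ N a (ℤ.- b)) (cong (a /1+ N ℚ.+_) (/1+-homo-neg N b))

/1+-mono-< : ∀ N {a b} → a ℤ.< b → a /1+ N ℚ.< b /1+ N
/1+-mono-< N {a} {b} a<b = ℚ.toℚᵘ-cancel-<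
  (ℚᵘ.<-respˡ-≃ (ℚᵘ.≃-sym (toℚᵘ-/1+ a N)) (ℚᵘ.<-respʳ-≃ (ℚᵘ.≃-sym (toℚᵘ-/1+ b N))
    (*<* (ℤ.*-monoʳ-<-pos (+ suc N) a<b))))

/1+-cancel-< : ∀ N {a b} → a /1+ N ℚ.< b /1+ N → a ℤ.< b
/1+-cancel-< N {a} {b} lt with ℚᵘ.<-respˡ-≃ (toℚᵘ-/1+ a N) (ℚᵘ.<-respʳ-≃ (toℚᵘ-/1+ b N) (ℚ.toℚᵘ-mono-< lt))
... | *<* aN<bN = ℤ.*-cancelʳ-<-nonNeg (+ suc N) aN<bN

/1+-scale : ∀ N k → (k ℤ.* + suc N) /1+ N ≡ ⟦ k ⟧
/1+-scale N k = trans (/1+-cong N 0 (ℤ.*-identityʳ (k ℤ.* + suc N))) (sym (⟦⟧≡/1+0 k))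

0</1+ : ∀ N {a} → + 0 ℤ.< a → 0ℚ ℚ.< a /1+ N
0</1+ N {a} 0<a = subst (ℚ._< a /1+ N) (/1+-scale N (+ 0)) (/1+-mono-< N 0<a)

/1+<1 : ∀ N {a} → a ℤ.< + suc N → a /1+ N ℚ.< 1ℚ
/1+<1 N {a} a<S = subst (a /1+ N ℚ.<_) (trans (cong (_/1+ N) (sym (ℤ.*-identityˡ (+ suc N)))) (/1+-scale N (+ 1)))
  (/1+-mono-< N a<S)

⟦⟧-homo-sub : ∀ a b → ⟦ a ℤ.- b ⟧ ≡ ⟦ a ⟧ ℚ.- ⟦ b ⟧
⟦⟧-homo-sub a b rewrite ⟦⟧≡/1+0 (a ℤ.- b) | ⟦⟧≡/1+0 a | ⟦⟧≡/1+0 b = /1+-homo-sub 0 a b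

⟦⟧-mono-< : ∀ {a b} → a ℤ.< b → ⟦ a ⟧ ℚ.< ⟦ b ⟧
⟦⟧-mono-< {a} {b} rewrite ⟦⟧≡/1+0 a | ⟦⟧≡/1+0 b = /1+-mono-< 0

⟦⟧-cancel-< : ∀ {a b} → ⟦ a ⟧ ℚ.< ⟦ b ⟧ → a ℤ.< b
⟦⟧-cancel-< {a} {b} rewrite ⟦⟧≡/1+0 a | ⟦⟧≡/1+0 b = /1+-cancel-< 0

⟦⟧-mono-≤ : ∀ {a b} → a ℤ.≤ b → ⟦ a ⟧ ℚ.≤ ⟦ b ⟧
⟦⟧-mono-≤ {a} {b} a≤b with a ℤ.≟ b
... | yes refl = ℚ.≤-refl
... | no a≢b = ℚ.<⇒≤ (⟦⟧-mono-< (ℤ.≤∧≢⇒< a≤b a≢b))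

⟦⟧-injective : ∀ {a b} → ⟦ a ⟧ ≡ ⟦ b ⟧ → a ≡ b
⟦⟧-injective {a} {b} eq with ℤ.<-cmp a b
... | tri< a<b _ _ = ⊥-elim (ℚ.<-irrefl eq (⟦⟧-mono-< a<b))
... | tri≈ _ a≡b _ = a≡b
... | tri> _ _ b<a = ⊥-elim (ℚ.<-irrefl (sym eq) (⟦⟧-mono-< b<a))

⟦⟧-suc : ∀ d → ⟦ ℤ.suc d ⟧ ≡ ⟦ d ⟧ ℚ.+ 1ℚ
⟦⟧-suc d rewrite ⟦⟧≡/1+0 (ℤ.suc d) | ⟦⟧≡/1+0 d | ⟦⟧≡/1+0 (+ 1) =
  trans (cong (_/1+ 0) (ℤ.+-comm (+ 1) d)) (/1+-homo-+ 0 d (+ 1))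

0<q-p : ∀ {p q} → p ℚ.< q → 0ℚ ℚ.< q ℚ.- p
0<q-p {p} {q} p<q = subst (ℚ._< q ℚ.- p) (ℚ.+-inverseʳ p) (ℚ.+-monoˡ-< (ℚ.- p) p<q)

0≤q-p : ∀ {p q} → p ℚ.≤ q → 0ℚ ℚ.≤ q ℚ.- p
0≤q-p {p} {q} p≤q = subst (ℚ._≤ q ℚ.- p) (ℚ.+-inverseʳ p) (ℚ.+-monoˡ-≤ (ℚ.- p) p≤q)

≤∧≢⇒< : ∀ {p q} → p ℚ.≤ q → p ≢ q → p ℚ.< q
≤∧≢⇒< p≤q p≢q = ℚ.≰⇒> (λ q≤p → p≢q (ℚ.≤-antisym p≤q q≤p))

0<q-p⇒p<q : ∀ {p q} → 0ℚ ℚ.< q ℚ.- p → p ℚ.< q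
0<q-p⇒p<q {p} {q} h = subst₂ ℚ._<_ (ℚ.+-identityˡ p) eq (ℚ.+-monoˡ-< p h)
  where
  open ℚ-Solver.+-*-Solver using (solve; _:+_; _:-_; _:=_; con)
  eq : q ℚ.- p ℚ.+ p ≡ q
  eq = solve 2 (λ q p → q :- p :+ p := q) refl q p

q-p<q : ∀ {p} q → 0ℚ ℚ.< p → q ℚ.- p ℚ.< q
q-p<q {p} q 0<p = subst (q ℚ.- p ℚ.<_) (ℚ.+-identityʳ q) (ℚ.+-monoʳ-< q (ℚ.neg-antimono-< 0<p))

+m-+n≡+[m∸n] : ∀ {m n} → n ℕ.≤ m → + m ℤ.- + n ≡ + (m ∸ n)
+m-+n≡+[m∸n] {m} {n} n≤m = trans (ℤ.m-n≡m⊖n m n) (ℤ.≤-⊖ n≤m)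

+m-+n-1≡+[m∸1+n] : ∀ {m n} → n ℕ.< m → + m ℤ.- + n ℤ.- + 1 ≡ + (m ∸ suc n)
+m-+n-1≡+[m∸1+n] {m} {n} n<m =
  trans (solve 2 (λ m n → m :- n :- con (+ 1) := m :- (con (+ 1) :+ n)) refl (+ m) (+ n)) (+m-+n≡+[m∸n] n<m)
  where open ℤ-Solver.+-*-Solver using (solve; _:+_; _:-_; _:=_; con)

-- Floors

fract : ℚ → ℤ → ℚ
fract z d = z ℚ.- ⟦ d ⟧

record HasFloor (z : ℚ) (d : ℤ) : Set where
  constructor _,_
  field
    fract-pos : 0ℚ ℚ.< fract z d
    fract<1   : fract z d ℚ.< 1ℚ

module _ {z : ℚ} {d : ℤ} where

  hasFloor-lower : HasFloor z d → ⟦ d ⟧ ℚ.< z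
  hasFloor-lower (0<f , _) = 0<q-p⇒p<q 0<f

  hasFloor-upper : HasFloor z d → z ℚ.< ⟦ ℤ.suc d ⟧
  hasFloor-upper (_ , f<1) =
    subst₂ ℚ._<_ eq (trans (ℚ.+-comm 1ℚ ⟦ d ⟧) (sym (⟦⟧-suc d))) (ℚ.+-monoˡ-< ⟦ d ⟧ f<1)
    where
    open ℚ-Solver.+-*-Solver using (solve; _:+_; _:-_; _:=_; con)
    eq : fract z d ℚ.+ ⟦ d ⟧ ≡ z
    eq = solve 2 (λ z d → z :- d :+ d := z) refl z ⟦ d ⟧

  hasFloor-intro : ⟦ d ⟧ ℚ.< z → z ℚ.< ⟦ ℤ.suc d ⟧ → HasFloor z d
  hasFloor-intro d<z z<d+1 = 0<q-p d<z , subst₂ ℚ._<_ refl eq (ℚ.+-monoˡ-< (ℚ.- ⟦ d ⟧) z<d+1)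
    where
    open ℚ-Solver.+-*-Solver using (solve; _:+_; _:-_; _:=_; con)
    eq : ⟦ ℤ.suc d ⟧ ℚ.- ⟦ d ⟧ ≡ 1ℚ
    eq = trans (cong (ℚ._- ⟦ d ⟧) (⟦⟧-suc d)) (solve 1 (λ d → d :+ con 1ℚ :- d := con 1ℚ) refl ⟦ d ⟧)

  hasFloor-via : ∀ w → fract z d ≡ w → 0ℚ ℚ.< w → w ℚ.< 1ℚ → HasFloor z d
  hasFloor-via w eq 0<w w<1 = subst (0ℚ ℚ.<_) (sym eq) 0<w , subst (ℚ._< 1ℚ) (sym eq) w<1

  hasFloor-<⟦⟧⇒< : ∀ {k} → HasFloor z d → z ℚ.< ⟦ k ⟧ → d ℤ.< k
  hasFloor-<⟦⟧⇒< {k} fl z<k = ⟦⟧-cancel-< {d} {k} (ℚ.<-trans (hasFloor-lower fl) z<k)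

  hasFloor-<⇒<⟦⟧ : ∀ {k} → HasFloor z d → d ℤ.< k → z ℚ.< ⟦ k ⟧
  hasFloor-<⇒<⟦⟧ fl d<k = ℚ.<-≤-trans (hasFloor-upper fl) (⟦⟧-mono-≤ (ℤ.i<j⇒suc[i]≤j d<k))

  hasFloor-≢⟦⟧ : ∀ {k} → HasFloor z d → z ≢ ⟦ k ⟧
  hasFloor-≢⟦⟧ {k} fl refl =
    ℤ.<-irrefl refl (ℤ.<-≤-trans (⟦⟧-cancel-< {k} {ℤ.suc d} (hasFloor-upper fl))
                                  (ℤ.i<j⇒suc[i]≤j (⟦⟧-cancel-< {d} {k} (hasFloor-lower fl))))

hasFloor-sameSide : ∀ {z z' d} k → HasFloor z d → HasFloor z' d → (z ℚ.< ⟦ k ⟧) ⇔ (z' ℚ.< ⟦ k ⟧)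
hasFloor-sameSide k fl fl' =
  mk⇔ (λ z<k → hasFloor-<⇒<⟦⟧ {k = k} fl' (hasFloor-<⟦⟧⇒< {k = k} fl z<k))
      (λ z'<k → hasFloor-<⇒<⟦⟧ {k = k} fl (hasFloor-<⟦⟧⇒< {k = k} fl' z'<k))

hasFloor-pos : ∀ {z d} → HasFloor z (+ d) → 0ℚ ℚ.< z
hasFloor-pos {d = d} fl = ℚ.≤-<-trans (⟦⟧-mono-≤ {+ 0} {+ d} (ℤ.+≤+ z≤n)) (hasFloor-lower fl)

hasFloor-exists : ∀ m z → 0ℚ ℚ.< z → z ℚ.< ⟦ + m ⟧ → (∀ k → z ≢ ⟦ k ⟧) → ∃ λ d → d ℕ.< m × HasFloor z (+ d)
hasFloor-exists zero z 0<z z<0 _ = ⊥-elim (ℚ.<-asym 0<z z<0)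
hasFloor-exists (suc m) z 0<z z<1+m z∉ℤ with ℚ.<-cmp z ⟦ + m ⟧
... | tri< z<m _ _ = let (d , d<m , fl) = hasFloor-exists m z 0<z z<m z∉ℤ in d , ℕ.m<n⇒m<1+n d<m , fl
... | tri≈ _ z≡m _ = ⊥-elim (z∉ℤ (+ m) z≡m)
... | tri> _ _ m<z = m , ℕ.n<1+n m , hasFloor-intro {d = + m} m<z z<1+m

module _ {x y : ℚ} {a b : ℤ} (flx : HasFloor x a) (fly : HasFloor y b) where
  open HasFloor
  open ℚ-Solver.+-*-Solver using (solve; _:+_; _:-_; _:=_; con)

  hasFloor-sub-< : fract x a ℚ.< fract y b → HasFloor (y ℚ.- x) (b ℤ.- a)
  hasFloor-sub-< lt = hasFloor-via (fract y b ℚ.- fract x a) eq (0<q-p lt)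
    (ℚ.<-trans (q-p<q (fract y b) (fract-pos flx)) (fract<1 fly))
    where
    eq : fract (y ℚ.- x) (b ℤ.- a) ≡ fract y b ℚ.- fract x a
    eq = trans (cong (λ t → y ℚ.- x ℚ.- t) (⟦⟧-homo-sub b a))
      (solve 4 (λ x y A B → y :- x :- (B :- A) := (y :- B) :- (x :- A)) refl x y ⟦ a ⟧ ⟦ b ⟧)

  hasFloor-sub-> : fract y b ℚ.< fract x a → HasFloor (y ℚ.- x) (b ℤ.- a ℤ.- + 1)
  hasFloor-sub-> lt = hasFloor-via (1ℚ ℚ.- (fract x a ℚ.- fract y b)) eq
    (0<q-p (ℚ.<-trans (q-p<q (fract x a) (fract-pos fly)) (fract<1 flx)))
    (q-p<q 1ℚ (0<q-p lt))
    where
    eq : fract (y ℚ.- x) (b ℤ.- a ℤ.- + 1) ≡ 1ℚ ℚ.- (fract x a ℚ.- fract y b)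
    eq = trans (cong (λ t → y ℚ.- x ℚ.- t) (trans (⟦⟧-homo-sub (b ℤ.- a) (+ 1)) (cong (ℚ._- 1ℚ) (⟦⟧-homo-sub b a))))
      (solve 4 (λ x y A B → y :- x :- (B :- A :- con 1ℚ) := con 1ℚ :- ((x :- A) :- (y :- B))) refl x y ⟦ a ⟧ ⟦ b ⟧)

hasFloor-complement : ∀ {x a} M → HasFloor x a → HasFloor (⟦ M ⟧ ℚ.- x) (M ℤ.- a ℤ.- + 1)
hasFloor-complement {x} {a} M (0<f , f<1) = hasFloor-via (1ℚ ℚ.- fract x a) eq (0<q-p f<1) (q-p<q 1ℚ 0<f)
  where
  open ℚ-Solver.+-*-Solver using (solve; _:+_; _:-_; _:=_; con)
  eq : fract (⟦ M ⟧ ℚ.- x) (M ℤ.- a ℤ.- + 1) ≡ 1ℚ ℚ.- fract x a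
  eq = trans (cong (λ t → ⟦ M ⟧ ℚ.- x ℚ.- t) (trans (⟦⟧-homo-sub (M ℤ.- a) (+ 1)) (cong (ℚ._- 1ℚ) (⟦⟧-homo-sub M a))))
    (solve 3 (λ x A M → M :- x :- (M :- A :- con 1ℚ) := con 1ℚ :- (x :- A)) refl x ⟦ a ⟧ ⟦ M ⟧)

-- Subtraction of two-digit numbers in base S, without and with a borrow.
module _ (S : ℕ) where
  open +-*-Solver using (solve; _:+_; _:*_; _:=_; con)
  open ≡-Reasoning

  digits-sub : ∀ {a b s t} → a ℕ.≤ b → s ℕ.≤ t → (a ℕ.* S ℕ.+ s) ℕ.+ (b ∸ a) ℕ.* S ℕ.+ (t ∸ s) ≡ b ℕ.* S ℕ.+ t
  digits-sub {a} {b} {s} {t} a≤b s≤t = begin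
    (a ℕ.* S ℕ.+ s) ℕ.+ (b ∸ a) ℕ.* S ℕ.+ (t ∸ s)
      ≡⟨ solve 5 (λ a s x y S → (a :* S :+ s) :+ x :* S :+ y := (a :+ x) :* S :+ (s :+ y)) refl a s (b ∸ a) (t ∸ s) S ⟩
    (a ℕ.+ (b ∸ a)) ℕ.* S ℕ.+ (s ℕ.+ (t ∸ s))
      ≡⟨ cong₂ (λ x y → x ℕ.* S ℕ.+ y) (ℕ.m+[n∸m]≡n a≤b) (ℕ.m+[n∸m]≡n s≤t) ⟩
    b ℕ.* S ℕ.+ t ∎

  digits-sub-borrow : ∀ {a b s t} → a ℕ.< b → t ℕ.≤ s → s ∸ t ℕ.≤ S →
    (a ℕ.* S ℕ.+ s) ℕ.+ (b ∸ suc a) ℕ.* S ℕ.+ (S ∸ (s ∸ t)) ≡ b ℕ.* S ℕ.+ t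
  digits-sub-borrow {a} {b} {s} {t} a<b t≤s s-t≤S = begin
    (a ℕ.* S ℕ.+ s) ℕ.+ x ℕ.* S ℕ.+ (S ∸ c)
      ≡⟨ cong (λ y → (a ℕ.* S ℕ.+ y) ℕ.+ x ℕ.* S ℕ.+ (S ∸ c)) (sym (ℕ.m+[n∸m]≡n t≤s)) ⟩
    (a ℕ.* S ℕ.+ (t ℕ.+ c)) ℕ.+ x ℕ.* S ℕ.+ (S ∸ c)
      ≡⟨ solve 6 (λ a t c x u S → (a :* S :+ (t :+ c)) :+ x :* S :+ u := (a :+ x) :* S :+ t :+ (c :+ u)) refl a t c x (S ∸ c) S ⟩
    (a ℕ.+ x) ℕ.* S ℕ.+ t ℕ.+ (c ℕ.+ (S ∸ c))
      ≡⟨ cong ((a ℕ.+ x) ℕ.* S ℕ.+ t ℕ.+_) (ℕ.m+[n∸m]≡n s-t≤S) ⟩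
    (a ℕ.+ x) ℕ.* S ℕ.+ t ℕ.+ S
      ≡⟨ solve 4 (λ a x t S → (a :+ x) :* S :+ t :+ S := (con 1 :+ a :+ x) :* S :+ t) refl a x t S ⟩
    (suc a ℕ.+ x) ℕ.* S ℕ.+ t
      ≡⟨ cong (λ y → y ℕ.* S ℕ.+ t) (ℕ.m+[n∸m]≡n a<b) ⟩
    b ℕ.* S ℕ.+ t ∎
    where
    x c : ℕ
    x = b ∸ suc a
    c = s ∸ t

hasFloor-gap : ∀ N {A B d t} → B ℕ.+ d ℕ.* suc N ℕ.+ t ≡ A → 0 ℕ.< t → t ℕ.< suc N →
  HasFloor ((+ A ℤ.- + B) /1+ N) (+ d)
hasFloor-gap N {A} {B} {d} {t} A≡B+dS+t 0<t t<S =
  hasFloor-via ((+ t) /1+ N) fract≡ (0</1+ N (ℤ.+<+ 0<t)) (/1+<1 N (ℤ.+<+ t<S))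
  where
  open ℤ-Solver.+-*-Solver using (solve; _:+_; _:-_; _:*_; _:=_)
  open ≡-Reasoning
  gap : + A ℤ.- + B ℤ.- + d ℤ.* + suc N ≡ + t
  gap = begin
    + A ℤ.- + B ℤ.- + d ℤ.* + suc N
      ≡⟨ cong (λ x → + x ℤ.- + B ℤ.- + d ℤ.* + suc N) (sym A≡B+dS+t) ⟩
    + (B ℕ.+ d ℕ.* suc N ℕ.+ t) ℤ.- + B ℤ.- + d ℤ.* + suc N
      ≡⟨ cong (λ x → x ℤ.- + B ℤ.- + d ℤ.* + suc N)
           (trans (ℤ.pos-+ (B ℕ.+ d ℕ.* suc N) t) (cong (ℤ._+ + t) (trans (ℤ.pos-+ B (d ℕ.* suc N)) (cong (ℤ._+_ (+ B)) (ℤ.pos-* d (suc N)))))) ⟩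
    + B ℤ.+ + d ℤ.* + suc N ℤ.+ + t ℤ.- + B ℤ.- + d ℤ.* + suc N
      ≡⟨ solve 4 (λ B d S t → B :+ d :* S :+ t :- B :- d :* S := t) refl (+ B) (+ d) (+ suc N) (+ t) ⟩
    + t ∎
  fract≡ : fract ((+ A ℤ.- + B) /1+ N) (+ d) ≡ (+ t) /1+ N
  fract≡ = begin
    (+ A ℤ.- + B) /1+ N ℚ.- ⟦ + d ⟧              ≡⟨ cong (ℚ._-_ ((+ A ℤ.- + B) /1+ N)) (sym (/1+-scale N (+ d))) ⟩
    (+ A ℤ.- + B) /1+ N ℚ.- (+ d ℤ.* + suc N) /1+ N ≡⟨ sym (/1+-homo-sub N (+ A ℤ.- + B) (+ d ℤ.* + suc N)) ⟩
    (+ A ℤ.- + B ℤ.- + d ℤ.* + suc N) /1+ N       ≡⟨ cong (_/1+ N) gap ⟩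
    (+ t) /1+ N ∎

-- Levels of the m-Shi arrangement

ShiLevel : ℕ → ℤ → Set
ShiLevel m k = (ℤ.- (+ m) ℤ.< k) × (k ℤ.≤ + m)

shiLevel-zero : ∀ {m} → 1 ℕ.≤ m → ShiLevel m (+ 0)
shiLevel-zero {suc m} _ = ℤ.-<+ , ℤ.+≤+ z≤n

shiLevel-top : ∀ {m} → 1 ℕ.≤ m → ShiLevel m (+ m)
shiLevel-top {suc m} _ = ℤ.-<+ , ℤ.≤-refl

suc-shiLevel : ∀ {m d} → d ℕ.< m → ShiLevel m (+ suc d)
suc-shiLevel {suc m} d<m = ℤ.-<+ , ℤ.+≤+ d<m

hasFloor-unseparated : ∀ {m z z' d d'} → HasFloor z (+ d) → HasFloor z' (+ d') → d ℕ.< m → d' ℕ.< m →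
  (∀ k → ShiLevel m k → (z ℚ.< ⟦ k ⟧) ⇔ (z' ℚ.< ⟦ k ⟧)) → d ≡ d'
hasFloor-unseparated {m} {z} {z'} {d} {d'} fl fl' d<m d'<m same with ℕ.<-cmp d d'
... | tri≈ _ d≡d' _ = d≡d'
... | tri< d<d' _ _ = ⊥-elim (ℕ.<⇒≱ d<d' (ℕ.≤-pred (ℤ.drop‿+<+ (hasFloor-<⟦⟧⇒< {k = + suc d} fl'
        (Equivalence.to (same (+ suc d) (suc-shiLevel d<m)) (hasFloor-upper fl))))))
... | tri> _ _ d'<d = ⊥-elim (ℕ.<⇒≱ d'<d (ℕ.≤-pred (ℤ.drop‿+<+ (hasFloor-<⟦⟧⇒< {k = + suc d'} fl
        (Equivalence.from (same (+ suc d') (suc-shiLevel d'<m)) (hasFloor-upper fl'))))))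

sameRegion-floor≡ : ∀ {n m} {v w : Pt n} {d d'} → SameRegion m v w → ∀ a b → a Fin.< b →
  HasFloor (pair v a b) (+ d) → HasFloor (pair w a b) (+ d') → d ℕ.< m → d' ℕ.< m → d ≡ d'
sameRegion-floor≡ same a b a<b v-floor w-floor d<m d'<m =
  hasFloor-unseparated v-floor w-floor d<m d'<m (λ k lvl → same a b k (a<b , lvl))

sameRegion-sym : ∀ {n m} {v w : Pt n} → SameRegion m v w → SameRegion m w v
sameRegion-sym same a b k h = ⇔-sym (same a b k h)

pair-split : ∀ {n} (p : Pt n) c a b → pair p a b ≡ pair p c b ℚ.- pair p c a
pair-split p c a b = solve 3 (λ x y z → y :- z := (x :- z) :- (x :- y)) refl (p c) (p a) (p b)
  where open ℚ-Solver.+-*-Solver using (solve; _:-_; _:=_)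

consecutive⇒< : ∀ {n} {i j : Fin n} → toℕ j ≡ suc (toℕ i) → i Fin.< j
consecutive⇒< {i = i} j≡1+i = subst (toℕ i ℕ.<_) (sym j≡1+i) (ℕ.n<1+n (toℕ i))

consecutive⇒antitone : ∀ {n} (f : Pt n) → (∀ i j → toℕ j ≡ suc (toℕ i) → f j ℚ.< f i) →
  ∀ {a b} → a Fin.< b → f b ℚ.< f a
consecutive⇒antitone {n} f step {a} {b} a<b = go (toℕ b ∸ suc (toℕ a)) b (sym (ℕ.m+[n∸m]≡n a<b))
  where
  go : ∀ d b → toℕ b ≡ suc (toℕ a) ℕ.+ d → f b ℚ.< f a
  go zero b b≡a+1 = step a b (trans b≡a+1 (ℕ.+-identityʳ _))
  go (suc d) b b≡a+2+d = ℚ.<-trans (step c b b≡c+1) (go d c (Fin.toℕ-fromℕ< c<n))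
    where
    c<n : suc (toℕ a) ℕ.+ d ℕ.< n
    c<n = ℕ.<-trans (ℕ.n<1+n _) (subst (ℕ._< n) (trans b≡a+2+d (ℕ.+-suc (suc (toℕ a)) d)) (Fin.toℕ<n b))
    c : Fin n
    c = Fin.fromℕ< c<n
    b≡c+1 : toℕ b ≡ suc (toℕ c)
    b≡c+1 = trans b≡a+2+d (trans (ℕ.+-suc (suc (toℕ a)) d) (cong suc (sym (Fin.toℕ-fromℕ< c<n))))

-- Ranking by a strict total order on Fin K

count : ∀ {K} {P : Fin K → Set} → (∀ i → Dec (P i)) → ℕ
count {zero} P? = 0
count {suc K} P? with P? Fin.zero
... | yes _ = suc (count (P? ∘ Fin.suc))
... | no _ = count (P? ∘ Fin.suc)

count-mono : ∀ {K} {P Q : Fin K → Set} (P? : ∀ i → Dec (P i)) (Q? : ∀ i → Dec (Q i)) →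
  (∀ i → P i → Q i) → count P? ℕ.≤ count Q?
count-mono {zero} P? Q? P⊆Q = z≤n
count-mono {suc K} P? Q? P⊆Q with P? Fin.zero | Q? Fin.zero
... | yes _ | yes _ = s≤s (count-mono (P? ∘ Fin.suc) (Q? ∘ Fin.suc) (P⊆Q ∘ Fin.suc))
... | yes p | no ¬q = ⊥-elim (¬q (P⊆Q Fin.zero p))
... | no _ | yes _ = ℕ.m≤n⇒m≤1+n (count-mono (P? ∘ Fin.suc) (Q? ∘ Fin.suc) (P⊆Q ∘ Fin.suc))
... | no _ | no _ = count-mono (P? ∘ Fin.suc) (Q? ∘ Fin.suc) (P⊆Q ∘ Fin.suc)

count-monoˢ : ∀ {K} {P Q : Fin K → Set} (P? : ∀ i → Dec (P i)) (Q? : ∀ i → Dec (Q i)) →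
  (∀ i → P i → Q i) → ∀ j → ¬ P j → Q j → count P? ℕ.< count Q?
count-monoˢ {suc K} P? Q? P⊆Q j ¬pj qj with P? Fin.zero | Q? Fin.zero | j
... | yes p | no ¬q | _ = ⊥-elim (¬q (P⊆Q Fin.zero p))
... | yes p | yes _ | Fin.zero = ⊥-elim (¬pj p)
... | no _ | yes _ | Fin.zero = s≤s (count-mono (P? ∘ Fin.suc) (Q? ∘ Fin.suc) (P⊆Q ∘ Fin.suc))
... | no _ | no ¬q | Fin.zero = ⊥-elim (¬q qj)
... | yes _ | yes _ | Fin.suc j = s≤s (count-monoˢ (P? ∘ Fin.suc) (Q? ∘ Fin.suc) (P⊆Q ∘ Fin.suc) j ¬pj qj)
... | no _ | yes _ | Fin.suc j = ℕ.m≤n⇒m≤1+n (count-monoˢ (P? ∘ Fin.suc) (Q? ∘ Fin.suc) (P⊆Q ∘ Fin.suc) j ¬pj qj)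
... | no _ | no _ | Fin.suc j = count-monoˢ (P? ∘ Fin.suc) (Q? ∘ Fin.suc) (P⊆Q ∘ Fin.suc) j ¬pj qj

count≤ : ∀ {K} {P : Fin K → Set} (P? : ∀ i → Dec (P i)) → count P? ℕ.≤ K
count≤ {zero} P? = z≤n
count≤ {suc K} P? with P? Fin.zero
... | yes _ = s≤s (count≤ (P? ∘ Fin.suc))
... | no _ = ℕ.m≤n⇒m≤1+n (count≤ (P? ∘ Fin.suc))

count< : ∀ {K} {P : Fin K → Set} (P? : ∀ i → Dec (P i)) → ∀ j → ¬ P j → count P? ℕ.< K
count< {suc K} P? j ¬pj with P? Fin.zero | j
... | yes p | Fin.zero = ⊥-elim (¬pj p)
... | no _ | Fin.zero = s≤s (count≤ (P? ∘ Fin.suc))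
... | yes _ | Fin.suc j = s≤s (count< (P? ∘ Fin.suc) j ¬pj)
... | no _ | Fin.suc j = ℕ.m≤n⇒m≤1+n (count< (P? ∘ Fin.suc) j ¬pj)

module _ {K : ℕ} (f : Fin K → Fin K) (f-mono : ∀ {i j} → i Fin.< j → f i Fin.< f j) where
  private
    i≤fi : ∀ k (i : Fin K) → toℕ i ≡ k → k ℕ.≤ toℕ (f i)
    i≤fi zero i _ = z≤n
    i≤fi (suc k) i i≡1+k = ℕ.<-≤-trans (s≤s (i≤fi k j (Fin.toℕ-fromℕ< k<K))) (f-mono j<i)
      where
      k<K : k ℕ.< K
      k<K = ℕ.<-trans (subst (k ℕ.<_) (sym i≡1+k) (ℕ.n<1+n k)) (Fin.toℕ<n i)
      j : Fin K
      j = Fin.fromℕ< k<K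
      j<i : j Fin.< i
      j<i = subst₂ ℕ._<_ (sym (Fin.toℕ-fromℕ< k<K)) (sym i≡1+k) (ℕ.n<1+n k)

    fi≤i : ∀ d (i : Fin K) → suc (toℕ i) ℕ.+ d ≡ K → toℕ (f i) ℕ.≤ toℕ i
    fi≤i zero i i+1≡K = ℕ.<⇒≤pred (subst (toℕ (f i) ℕ.<_) (trans (sym i+1≡K) (ℕ.+-identityʳ _)) (Fin.toℕ<n (f i)))
    fi≤i (suc d) i i+1+d≡K =
      ℕ.<⇒≤pred (ℕ.<-≤-trans (f-mono i<j) (subst (toℕ (f j) ℕ.≤_) (Fin.toℕ-fromℕ< i+1<K) (fi≤i d j j+1+d≡K)))
      where
      i+1<K : suc (toℕ i) ℕ.< K
      i+1<K = subst (suc (toℕ i) ℕ.<_) i+1+d≡K (ℕ.m<m+n (suc (toℕ i)) (s≤s z≤n))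
      j : Fin K
      j = Fin.fromℕ< i+1<K
      i<j : i Fin.< j
      i<j = subst (toℕ i ℕ.<_) (sym (Fin.toℕ-fromℕ< i+1<K)) (ℕ.n<1+n (toℕ i))
      j+1+d≡K : suc (toℕ j) ℕ.+ d ≡ K
      j+1+d≡K = trans (cong (λ t → suc t ℕ.+ d) (Fin.toℕ-fromℕ< i+1<K))
                      (trans (sym (ℕ.+-suc (suc (toℕ i)) d)) i+1+d≡K)

  strictMono⇒≗id : ∀ i → f i ≡ i
  strictMono⇒≗id i = Fin.toℕ-injective (ℕ.≤-antisym
    (fi≤i (K ℕ.∸ suc (toℕ i)) i (ℕ.m+[n∸m]≡n (Fin.toℕ<n i))) (i≤fi (toℕ i) i refl))

injective⇒surjective : ∀ {K} (f : Fin K → Fin K) → (∀ {i j} → f i ≡ f j → i ≡ j) → ∀ r → ∃ λ i → f i ≡ r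
injective⇒surjective {suc K} f f-inj r with Fin.any? (λ i → f i Fin.≟ r)
... | yes hit = hit
... | no miss = ⊥-elim (ℕ.<-irrefl refl (Fin.injective⇒≤ f-avoiding-r-injective))
  where
  f-avoiding-r : Fin (suc K) → Fin K
  f-avoiding-r i = Fin.punchOut {i = r} (λ r≡fi → miss (i , sym r≡fi))
  f-avoiding-r-injective : ∀ {i j} → f-avoiding-r i ≡ f-avoiding-r j → i ≡ j
  f-avoiding-r-injective {i} {j} eq =
    f-inj (Fin.punchOut-injective (λ r≡fi → miss (i , sym r≡fi)) (λ r≡fj → miss (j , sym r≡fj)) eq)

module Ranking {K : ℕ} (_≺_ : Fin K → Fin K → Set) (_≺?_ : ∀ i j → Dec (i ≺ j))
  (≺-irrefl : ∀ i → ¬ i ≺ i) (≺-trans : ∀ {i j k} → i ≺ j → j ≺ k → i ≺ k)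
  (≺-connex : ∀ i j → i ≢ j → i ≺ j ⊎ j ≺ i) where

  opaque
    private
      rank< : ∀ i → count (_≺? i) ℕ.< K
      rank< i = count< (_≺? i) i (≺-irrefl i)

    rank : Fin K → Fin K
    rank i = Fin.fromℕ< (rank< i)

    rank-mono : ∀ {i j} → i ≺ j → rank i Fin.< rank j
    rank-mono {i} {j} i≺j = subst₂ ℕ._<_ (sym (Fin.toℕ-fromℕ< (rank< i))) (sym (Fin.toℕ-fromℕ< (rank< j)))
      (count-monoˢ (_≺? i) (_≺? j) (λ k k≺i → ≺-trans k≺i i≺j) i (≺-irrefl i) i≺j)

    rank-cancel : ∀ {i j} → rank i Fin.< rank j → i ≺ j
    rank-cancel {i} {j} ri<rj with i Fin.≟ j
    ... | yes refl = ⊥-elim (ℕ.<-irrefl refl ri<rj)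
    ... | no i≢j with ≺-connex i j i≢j
    ...   | inj₁ i≺j = i≺j
    ...   | inj₂ j≺i = ⊥-elim (ℕ.<-asym ri<rj (rank-mono j≺i))

    rank-injective : ∀ {i j} → rank i ≡ rank j → i ≡ j
    rank-injective {i} {j} eq with i Fin.≟ j
    ... | yes i≡j = i≡j
    ... | no i≢j with ≺-connex i j i≢j
    ...   | inj₁ i≺j = ⊥-elim (ℕ.<-irrefl (cong toℕ eq) (rank-mono i≺j))
    ...   | inj₂ j≺i = ⊥-elim (ℕ.<-irrefl (cong toℕ (sym eq)) (rank-mono j≺i))

    unrank : Fin K → Fin K
    unrank r = proj₁ (injective⇒surjective rank rank-injective r)

    rank-unrank : ∀ r → rank (unrank r) ≡ r
    rank-unrank r = proj₂ (injective⇒surjective rank rank-injective r)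

    unrank-rank : ∀ i → unrank (rank i) ≡ i
    unrank-rank i = rank-injective (rank-unrank (rank i))

    unrank-injective : ∀ {r s} → unrank r ≡ unrank s → r ≡ s
    unrank-injective {r} {s} eq = trans (sym (rank-unrank r)) (trans (cong rank eq) (rank-unrank s))

    unrank-cancel : ∀ {r s} → r Fin.< s → unrank r ≺ unrank s
    unrank-cancel {r} {s} r<s = rank-cancel (subst₂ Fin._<_ (sym (rank-unrank r)) (sym (rank-unrank s)) r<s)

funToFin-cong : ∀ {a b} {f f' : Fin a → Fin b} → (∀ i → f i ≡ f' i) → Fin.funToFin f ≡ Fin.funToFin f'
funToFin-cong {zero} f≗f' = refl
funToFin-cong {suc a} f≗f' = cong₂ Fin.combine (f≗f' Fin.zero) (funToFin-cong (f≗f' ∘ Fin.suc))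

finToFun-injective : ∀ {a b} {i j : Fin (b ^ a)} → (∀ r → Fin.finToFun {b} {a} i r ≡ Fin.finToFun j r) → i ≡ j
finToFun-injective {a} {b} {i} {j} i≗j =
  trans (sym (Fin.funToFin-finToFin {a} {b} i)) (trans (funToFin-cong i≗j) (Fin.funToFin-finToFin {a} {b} j))

-- Points of V with prescribed heights

sumℤ : ∀ {k} → (Fin k → ℤ) → ℤ
sumℤ {zero} f = + 0
sumℤ {suc k} f = f Fin.zero ℤ.+ sumℤ (f ∘ Fin.suc)

sumℚ-/1+ : ∀ M {k} (f : Fin k → ℤ) → sumℚ (λ x → f x /1+ M) ≡ sumℤ f /1+ M
sumℚ-/1+ M {zero} f = sym (/1+-scale M (+ 0))
sumℚ-/1+ M {suc k} f = trans (cong (f Fin.zero /1+ M ℚ.+_) (sumℚ-/1+ M (f ∘ Fin.suc)))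
                              (sym (/1+-homo-+ M (f Fin.zero) (sumℤ (f ∘ Fin.suc))))

sumℤ-affine : ∀ {k} (c d : ℤ) (f : Fin k → ℤ) → sumℤ (λ x → c ℤ.- d ℤ.* f x) ≡ + k ℤ.* c ℤ.- d ℤ.* sumℤ f
sumℤ-affine {zero} c d f = solve 2 (λ c d → con (+ 0) := con (+ 0) :* c :- d :* con (+ 0)) refl c d
  where open ℤ-Solver.+-*-Solver using (solve; _:+_; _:-_; _:*_; _:=_; con)
sumℤ-affine {suc k} c d f = begin
  c ℤ.- d ℤ.* f Fin.zero ℤ.+ sumℤ (λ x → c ℤ.- d ℤ.* f (Fin.suc x))
    ≡⟨ cong (λ t → c ℤ.- d ℤ.* f Fin.zero ℤ.+ t) (sumℤ-affine c d (f ∘ Fin.suc)) ⟩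
  c ℤ.- d ℤ.* f Fin.zero ℤ.+ (+ k ℤ.* c ℤ.- d ℤ.* sumℤ (f ∘ Fin.suc))
    ≡⟨ solve 5 (λ c d x s k → c :- d :* x :+ (k :* c :- d :* s) := (con (+ 1) :+ k) :* c :- d :* (x :+ s))
             refl c d (f Fin.zero) (sumℤ (f ∘ Fin.suc)) (+ k) ⟩
  (+ 1 ℤ.+ + k) ℤ.* c ℤ.- d ℤ.* sumℤ f
    ≡⟨ cong (λ t → t ℤ.* c ℤ.- d ℤ.* sumℤ f) (sym (ℤ.pos-+ 1 k)) ⟩
  + suc k ℤ.* c ℤ.- d ℤ.* sumℤ f ∎
  where
  open ≡-Reasoning
  open ℤ-Solver.+-*-Solver using (solve; _:+_; _:-_; _:*_; _:=_; con)

module _ {n : ℕ} (N : ℕ) where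

  opaque
    -- The point of V with coordinates (mean Q - Q x) / (1 + N); note 1 + (N + n (1 + N)) = (1 + n) (1 + N).
    heightPoint : (Fin (suc n) → ℤ) → Pt (suc n)
    heightPoint Q x = (sumℤ Q ℤ.- + suc n ℤ.* Q x) /1+ (N ℕ.+ n ℕ.* suc N)

    heightPoint-InV : ∀ Q → InV (heightPoint Q)
    heightPoint-InV Q = begin
      sumℚ (heightPoint Q)                                      ≡⟨ sumℚ-/1+ M (λ x → sumℤ Q ℤ.- + suc n ℤ.* Q x) ⟩
      sumℤ (λ x → sumℤ Q ℤ.- + suc n ℤ.* Q x) /1+ M             ≡⟨ cong (_/1+ M) (sumℤ-affine (sumℤ Q) (+ suc n) Q) ⟩
      (+ suc n ℤ.* sumℤ Q ℤ.- + suc n ℤ.* sumℤ Q) /1+ M         ≡⟨ cong (_/1+ M) (ℤ.+-inverseʳ (+ suc n ℤ.* sumℤ Q)) ⟩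
      + 0 /1+ M                                                 ≡⟨ /1+-scale M (+ 0) ⟩
      0ℚ                                                        ∎
      where
      open ≡-Reasoning
      M : ℕ
      M = N ℕ.+ n ℕ.* suc N

    pair-heightPoint : ∀ Q a b → pair (heightPoint Q) a b ≡ (Q b ℤ.- Q a) /1+ N
    pair-heightPoint Q a b = trans (sym (/1+-homo-sub M (S ℤ.- n' ℤ.* Q a) (S ℤ.- n' ℤ.* Q b)))
                                   (/1+-cong M N eq)
      where
      open ℤ-Solver.+-*-Solver using (solve; _:+_; _:-_; _:*_; _:=_; con)
      M : ℕ
      M = N ℕ.+ n ℕ.* suc N
      S : ℤ
      S = sumℤ Q
      n' : ℤ
      n' = + suc n
      eq : (S ℤ.- n' ℤ.* Q a ℤ.- (S ℤ.- n' ℤ.* Q b)) ℤ.* + suc N ≡ (Q b ℤ.- Q a) ℤ.* + suc M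
      eq = trans (solve 5 (λ S A B n N → (S :- n :* A :- (S :- n :* B)) :* N := (B :- A) :* (n :* N))
                          refl S (Q a) (Q b) n' (+ suc N))
                 (cong ((Q b ℤ.- Q a) ℤ.*_) (sym (ℤ.pos-* (suc n) (suc N))))

-- First, middle and last coordinates

inject₁-or-fromℕ : ∀ {k} (y : Fin (suc k)) → (∃ λ j → y ≡ Fin.inject₁ j) ⊎ (y ≡ Fin.fromℕ k)
inject₁-or-fromℕ {zero} Fin.zero = inj₂ refl
inject₁-or-fromℕ {suc k} Fin.zero = inj₁ (Fin.zero , refl)
inject₁-or-fromℕ {suc k} (Fin.suc y) with inject₁-or-fromℕ y
... | inj₁ (j , y≡j) = inj₁ (Fin.suc j , cong Fin.suc y≡j)
... | inj₂ y≡k = inj₂ (cong Fin.suc y≡k)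

infixl 5 _∷ʳ_

_∷ʳ_ : ∀ {k} → (Fin k → ℕ) → ℕ → Fin (suc k) → ℕ
_∷ʳ_ {zero} q t _ = t
_∷ʳ_ {suc k} q t Fin.zero = q Fin.zero
_∷ʳ_ {suc k} q t (Fin.suc x) = (q ∘ Fin.suc ∷ʳ t) x

∷ʳ-inject₁ : ∀ {k} (q : Fin k → ℕ) t i → (q ∷ʳ t) (Fin.inject₁ i) ≡ q i
∷ʳ-inject₁ {suc k} q t Fin.zero = refl
∷ʳ-inject₁ {suc k} q t (Fin.suc i) = ∷ʳ-inject₁ (q ∘ Fin.suc) t i

∷ʳ-fromℕ : ∀ {k} (q : Fin k → ℕ) t → (q ∷ʳ t) (Fin.fromℕ k) ≡ t
∷ʳ-fromℕ {zero} q t = refl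
∷ʳ-fromℕ {suc k} q t = ∷ʳ-fromℕ (q ∘ Fin.suc) t

module Layout (K : ℕ) where

  mid : Fin K → Fin (suc (suc K))
  mid i = Fin.suc (Fin.inject₁ i)

  last : Fin (suc (suc K))
  last = Fin.fromℕ (suc K)

  toℕ-mid : ∀ i → toℕ (mid i) ≡ suc (toℕ i)
  toℕ-mid i = cong suc (Fin.toℕ-inject₁ i)

  toℕ-last : toℕ last ≡ suc K
  toℕ-last = Fin.toℕ-fromℕ (suc K)

  first<mid : ∀ i → Fin.zero {suc K} Fin.< mid i
  first<mid i = subst (0 ℕ.<_) (sym (toℕ-mid i)) (s≤s z≤n)

  first<last : Fin.zero {suc K} Fin.< last
  first<last = subst (0 ℕ.<_) (sym toℕ-last) (s≤s z≤n)

  mid<last : ∀ i → mid i Fin.< last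
  mid<last i = subst₂ ℕ._<_ (sym (toℕ-mid i)) (sym toℕ-last) (s≤s (Fin.toℕ<n i))

  mid-mono : ∀ {i j} → i Fin.< j → mid i Fin.< mid j
  mid-mono {i} {j} i<j = subst₂ ℕ._<_ (sym (toℕ-mid i)) (sym (toℕ-mid j)) (s≤s i<j)

  mid≢last : ∀ i → mid i ≢ last
  mid≢last i eq = ℕ.<⇒≢ (mid<last i) (cong toℕ eq)

  data Slot : Fin (suc (suc K)) → Set where
    first : Slot Fin.zero
    middle : ∀ i → Slot (mid i)
    final : Slot last

  slot : ∀ x → Slot x
  slot Fin.zero = first
  slot (Fin.suc x) = shift (inject₁-or-fromℕ x)
    where
    shift : (∃ λ j → x ≡ Fin.inject₁ j) ⊎ (x ≡ Fin.fromℕ K) → Slot (Fin.suc x)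
    shift (inj₁ (j , refl)) = middle j
    shift (inj₂ refl) = final

  data OrderedPair : Fin (suc (suc K)) → Fin (suc (suc K)) → Set where
    first-mid : ∀ j → OrderedPair Fin.zero (mid j)
    first-last : OrderedPair Fin.zero last
    mid-mid : ∀ {i j} → i Fin.< j → OrderedPair (mid i) (mid j)
    mid-last : ∀ i → OrderedPair (mid i) last

  orderedPair : ∀ {a b} → a Fin.< b → OrderedPair a b
  orderedPair {a} {b} a<b with slot a | slot b
  ... | first | first = ⊥-elim (ℕ.<-irrefl refl a<b)
  ... | first | middle j = first-mid j
  ... | first | final = first-last
  ... | middle i | first = ⊥-elim (ℕ.<-asym a<b (first<mid i))
  ... | middle i | middle j = mid-mid (ℕ.≤-pred (subst₂ ℕ._<_ (toℕ-mid i) (toℕ-mid j) a<b))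
  ... | middle i | final = mid-last i
  ... | final | first = ⊥-elim (ℕ.<-asym a<b first<last)
  ... | final | middle j = ⊥-elim (ℕ.<-asym a<b (mid<last j))
  ... | final | final = ⊥-elim (ℕ.<-irrefl refl a<b)

  stack : (Fin K → ℕ) → ℕ → Fin (suc (suc K)) → ℕ
  stack q t Fin.zero = 0
  stack q t (Fin.suc x) = (q ∷ʳ t) x

  stack-mid : ∀ q t i → stack q t (mid i) ≡ q i
  stack-mid q t i = ∷ʳ-inject₁ q t i

  stack-last : ∀ q t → stack q t last ≡ t
  stack-last q t = ∷ʳ-fromℕ q t

-- The regions

module Regions (K m : ℕ) (m≥1 : 1 ℕ.≤ m) where
  open Layout K public

  n : ℕ
  n = suc (suc K)

  N : ℕ
  N = suc K

  S : ℕ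
  S = suc N

  θ-shiHyp : ShiHyp m Fin.zero last (+ m)
  θ-shiHyp = first<last , shiLevel-top m≥1

  beyond-θ : ∀ {z k} → ⟦ + m ⟧ ℚ.≤ z → k ℤ.≤ + m → ¬ z ℚ.< ⟦ k ⟧
  beyond-θ {k = k} m≤z k≤m z<k = ℤ.<⇒≱ (⟦⟧-cancel-< {+ m} {k} (ℚ.≤-<-trans m≤z z<k)) k≤m

  A0-below-θ : ∀ {x} → InA0 Fin.zero last x → pair x Fin.zero last ℚ.< ⟦ + m ⟧
  A0-below-θ (_ , x<1 , _) = ℚ.<-≤-trans x<1 (⟦⟧-mono-≤ (ℤ.+≤+ m≥1))

  A0-point : Pt n
  A0-point = heightPoint N (λ x → + toℕ x)

  A0-point∈A0 : InA0 Fin.zero last A0-point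
  A0-point∈A0 = heightPoint-InV {suc K} N (λ x → + toℕ x) , θ<1 , decreasing
    where
    pair≡ : ∀ a b → pair A0-point a b ≡ (+ toℕ b ℤ.- + toℕ a) /1+ N
    pair≡ = pair-heightPoint N (λ x → + toℕ x)
    θ<1 : pair A0-point Fin.zero last ℚ.< 1ℚ
    θ<1 = subst (ℚ._< 1ℚ) (sym (pair≡ Fin.zero last))
      (/1+<1 N (subst (ℤ._< + S) (sym (trans (ℤ.+-identityʳ _) (cong +_ toℕ-last))) (ℤ.+<+ (ℕ.n<1+n (suc K)))))
    decreasing : ∀ i j → toℕ j ≡ suc (toℕ i) → A0-point j ℚ.< A0-point i
    decreasing i j j≡1+i = 0<q-p⇒p<q (subst (0ℚ ℚ.<_) (sym (pair≡ i j))
      (0</1+ N (subst (+ 0 ℤ.<_) (sym (+m-+n≡+[m∸n] (ℕ.<⇒≤ i<j))) (ℤ.+<+ (ℕ.m<n⇒0<n∸m i<j)))))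
      where
      i<j : i Fin.< j
      i<j = consecutive⇒< j≡1+i

  -- The point rep g: list the labels r in increasing order of (g r , r) as σ 0, σ 1, …; the j-th
  -- middle coordinate gets height g (σ j) + (2 + σ j) / S above the first one and the last coordinate
  -- height m + 1 / S, just beyond H_{θ,m}.  Moving the last one down to height m gives the wall point.
  module Representative (g : Fin K → Fin m) where

    _◁_ : Fin K → Fin K → Set
    r ◁ r' = ×-Lex _≡_ Fin._<_ Fin._<_ (g r , r) (g r' , r')

    ◁-connex : ∀ r r' → r ≢ r' → r ◁ r' ⊎ r' ◁ r
    ◁-connex r r' r≢r' = from-tri (×-compare sym Fin.<-cmp Fin.<-cmp (g r , r) (g r' , r'))
      where
      from-tri : Tri (r ◁ r') ((g r ≡ g r') × (r ≡ r')) (r' ◁ r) → r ◁ r' ⊎ r' ◁ r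
      from-tri (tri< r◁r' _ _) = inj₁ r◁r'
      from-tri (tri≈ _ (_ , r≡r') _) = ⊥-elim (r≢r' r≡r')
      from-tri (tri> _ _ r'◁r) = inj₂ r'◁r

    ◁-trans : ∀ {r r' r''} → r ◁ r' → r' ◁ r'' → r ◁ r''
    ◁-trans {r} {r'} {r''} = ×-transitive {_≈₁_ = _≡_} {_<₁_ = Fin._<_} {_<₂_ = Fin._<_}
      isEquivalence Fin.<-resp₂-≡ Fin.<-trans Fin.<-trans {g r , r} {g r' , r'} {g r'' , r''}

    ◁-irrefl : ∀ r → ¬ r ◁ r
    ◁-irrefl r = ×-irreflexive {_≈₁_ = _≡_} {_<₁_ = Fin._<_} {_≈₂_ = _≡_} {_<₂_ = Fin._<_}
      Fin.<-irrefl Fin.<-irrefl {g r , r} {g r , r} (refl , refl)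

    open Ranking _◁_ (λ r r' → ×-decidable Fin._≟_ Fin._<?_ Fin._<?_ (g r , r) (g r' , r'))
      ◁-irrefl ◁-trans ◁-connex public
      renaming (unrank to σ)

    floorAt : Fin K → ℕ
    floorAt j = toℕ (g (σ j))

    fractAt : Fin K → ℕ
    fractAt j = suc (suc (toℕ (σ j)))

    height : Fin K → ℕ
    height j = floorAt j ℕ.* S ℕ.+ fractAt j

    floorAt<m : ∀ j → floorAt j ℕ.< m
    floorAt<m j = Fin.toℕ<n (g (σ j))

    fractAt<S : ∀ j → fractAt j ℕ.< S
    fractAt<S j = s≤s (s≤s (Fin.toℕ<n (σ j)))

    floorAt-mono : ∀ {i j} → i Fin.< j → floorAt i ℕ.≤ floorAt j
    floorAt-mono i<j = [ ℕ.<⇒≤ , (λ (gi≡gj , _) → ℕ.≤-reflexive (cong toℕ gi≡gj)) ]′ (unrank-cancel i<j)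

    floorAt-monoˢ : ∀ {i j} → i Fin.< j → σ j Fin.< σ i → floorAt i ℕ.< floorAt j
    floorAt-monoˢ i<j σj<σi = [ id , (λ (_ , σi<σj) → ⊥-elim (ℕ.<-asym σi<σj σj<σi)) ]′ (unrank-cancel i<j)

    point : ℕ → Pt n
    point T = heightPoint N (λ x → + stack height T x)

    rep : Pt n
    rep = point (m ℕ.* S ℕ.+ 1)

    wall : Pt n
    wall = point (m ℕ.* S ℕ.+ 0)

    module _ (T : ℕ) where
      private
        pair-point : ∀ a b → pair (point T) a b ≡ (+ stack height T b ℤ.- + stack height T a) /1+ N
        pair-point = pair-heightPoint N (λ x → + stack height T x)

      point-InV : InV (point T)
      point-InV = heightPoint-InV N (λ x → + stack height T x)

      pair-first-mid : ∀ j → pair (point T) Fin.zero (mid j) ≡ (+ height j ℤ.- + 0) /1+ N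
      pair-first-mid j = trans (pair-point Fin.zero (mid j)) (cong (λ x → (+ x ℤ.- + 0) /1+ N) (stack-mid height T j))

      pair-mid-mid : ∀ i j → pair (point T) (mid i) (mid j) ≡ (+ height j ℤ.- + height i) /1+ N
      pair-mid-mid i j = trans (pair-point (mid i) (mid j))
        (cong₂ (λ x y → (+ x ℤ.- + y) /1+ N) (stack-mid height T j) (stack-mid height T i))

      pair-mid-last : ∀ i → pair (point T) (mid i) last ≡ (+ T ℤ.- + height i) /1+ N
      pair-mid-last i = trans (pair-point (mid i) last)
        (cong₂ (λ x y → (+ x ℤ.- + y) /1+ N) (stack-last height T) (stack-mid height T i))

      pair-first-last : pair (point T) Fin.zero last ≡ (+ T ℤ.- + 0) /1+ N
      pair-first-last = trans (pair-point Fin.zero last) (cong (λ x → (+ x ℤ.- + 0) /1+ N) (stack-last height T))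

      floor-first-mid : ∀ j → HasFloor (pair (point T) Fin.zero (mid j)) (+ floorAt j)
      floor-first-mid j = subst (λ z → HasFloor z (+ floorAt j)) (sym (pair-first-mid j))
        (hasFloor-gap N {B = 0} refl (s≤s z≤n) (fractAt<S j))

      floor-mid-mid-< : ∀ {i j} → i Fin.< j → σ i Fin.< σ j →
        HasFloor (pair (point T) (mid i) (mid j)) (+ (floorAt j ∸ floorAt i))
      floor-mid-mid-< {i} {j} i<j σi<σj = subst (λ z → HasFloor z (+ (floorAt j ∸ floorAt i))) (sym (pair-mid-mid i j))
        (hasFloor-gap N {height j} {height i} (digits-sub S (floorAt-mono i<j) (ℕ.<⇒≤ si<sj)) (ℕ.m<n⇒0<n∸m si<sj)
          (ℕ.≤-<-trans (ℕ.m∸n≤m (fractAt j) (fractAt i)) (fractAt<S j)))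
        where
        si<sj : fractAt i ℕ.< fractAt j
        si<sj = s≤s (s≤s σi<σj)

      floor-mid-mid-> : ∀ {i j} → i Fin.< j → σ j Fin.< σ i →
        HasFloor (pair (point T) (mid i) (mid j)) (+ (floorAt j ∸ suc (floorAt i)))
      floor-mid-mid-> {i} {j} i<j σj<σi = subst (λ z → HasFloor z (+ (floorAt j ∸ suc (floorAt i)))) (sym (pair-mid-mid i j))
        (hasFloor-gap N {height j} {height i} (digits-sub-borrow S (floorAt-monoˢ i<j σj<σi) (ℕ.<⇒≤ sj<si) (ℕ.<⇒≤ si-sj<S))
          (ℕ.m<n⇒0<n∸m si-sj<S) (ℕ.∸-monoʳ-< (ℕ.m<n⇒0<n∸m sj<si) (ℕ.<⇒≤ si-sj<S)))
        where
        sj<si : fractAt j ℕ.< fractAt i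
        sj<si = s≤s (s≤s σj<σi)
        si-sj<S : fractAt i ∸ fractAt j ℕ.< S
        si-sj<S = ℕ.≤-<-trans (ℕ.m∸n≤m (fractAt i) (fractAt j)) (fractAt<S i)

    floor-mid-last : ∀ {t} → t ℕ.≤ 1 → ∀ i →
      HasFloor (pair (point (m ℕ.* S ℕ.+ t)) (mid i) last) (+ (m ∸ suc (floorAt i)))
    floor-mid-last {t} t≤1 i = subst (λ z → HasFloor z (+ (m ∸ suc (floorAt i)))) (sym (pair-mid-last _ i))
      (hasFloor-gap N {m ℕ.* S ℕ.+ t} {height i}
        (digits-sub-borrow S (floorAt<m i) t≤si (ℕ.<⇒≤ si-t<S))
        (ℕ.m<n⇒0<n∸m si-t<S) (ℕ.∸-monoʳ-< (ℕ.m<n⇒0<n∸m t<si) (ℕ.<⇒≤ si-t<S)))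
      where
      t<si : t ℕ.< fractAt i
      t<si = ℕ.≤-<-trans t≤1 (s≤s (s≤s z≤n))
      t≤si : t ℕ.≤ fractAt i
      t≤si = ℕ.<⇒≤ t<si
      si-t<S : fractAt i ∸ t ℕ.< S
      si-t<S = ℕ.≤-<-trans (ℕ.m∸n≤m (fractAt i) t) (fractAt<S i)

    floor-first-last : HasFloor (pair rep Fin.zero last) (+ m)
    floor-first-last = subst (λ z → HasFloor z (+ m)) (sym (pair-first-last _))
      (hasFloor-gap N {B = 0} refl (s≤s z≤n) (s≤s (s≤s z≤n)))

    wall-on-θ : pair wall Fin.zero last ≡ ⟦ + m ⟧
    wall-on-θ = trans (pair-first-last _) (trans (cong (_/1+ N) height≡) (/1+-scale N (+ m)))
      where
      height≡ : + (m ℕ.* S ℕ.+ 0) ℤ.- + 0 ≡ + m ℤ.* + S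
      height≡ = trans (ℤ.+-identityʳ _) (trans (cong +_ (ℕ.+-identityʳ _)) (ℤ.pos-* m S))

    SharedFloor : Fin n → Fin n → Set
    SharedFloor a b = Σ ℕ λ d → HasFloor (pair rep a b) (+ d) × ((a ≡ Fin.zero × b ≡ last) ⊎ HasFloor (pair wall a b) (+ d))

    rep-wall-floor : ∀ {a b} → a Fin.< b → SharedFloor a b
    rep-wall-floor a<b = by-pair (orderedPair a<b)
      where
      by-σ : ∀ {i j} → i Fin.< j → Tri (σ i Fin.< σ j) (σ i ≡ σ j) (σ j Fin.< σ i) →
        Σ ℕ λ d → HasFloor (pair rep (mid i) (mid j)) (+ d) × HasFloor (pair wall (mid i) (mid j)) (+ d)
      by-σ i<j (tri< σi<σj _ _) = _ , floor-mid-mid-< _ i<j σi<σj , floor-mid-mid-< _ i<j σi<σj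
      by-σ i<j (tri≈ _ σi≡σj _) = ⊥-elim (Fin.<-irrefl (unrank-injective σi≡σj) i<j)
      by-σ i<j (tri> _ _ σj<σi) = _ , floor-mid-mid-> _ i<j σj<σi , floor-mid-mid-> _ i<j σj<σi

      by-pair : ∀ {a b} → OrderedPair a b → SharedFloor a b
      by-pair (first-mid j) = _ , floor-first-mid _ j , inj₂ (floor-first-mid _ j)
      by-pair first-last = _ , floor-first-last , inj₁ (refl , refl)
      by-pair (mid-last i) = _ , floor-mid-last ℕ.≤-refl i , inj₂ (floor-mid-last z≤n i)
      by-pair (mid-mid {i} {j} i<j) =
        let (d , rep-floor , wall-floor) = by-σ i<j (Fin.<-cmp (σ i) (σ j)) in d , rep-floor , inj₂ wall-floor

    rep-qualifies : Qualifies m Fin.zero last rep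
    rep-qualifies =
      point-InV _ , off-arrangement , dominant , (θ-shiHyp , wall , point-InV _ , wall-on-θ , wall-sides) , separates
      where
      off-arrangement : OffArr m rep
      off-arrangement a b k (a<b , _) = hasFloor-≢⟦⟧ {k = k} (proj₁ (proj₂ (rep-wall-floor a<b)))

      dominant : Dominant rep
      dominant i j j≡1+i = ℚ.<⇒≤ (0<q-p⇒p<q (hasFloor-pos (proj₁ (proj₂ (rep-wall-floor (consecutive⇒< j≡1+i))))))

      WallSide : Fin n → Fin n → ℤ → Set
      WallSide a b k = (pair wall a b ≢ ⟦ k ⟧) × ((pair wall a b ℚ.< ⟦ k ⟧) ⇔ (pair rep a b ℚ.< ⟦ k ⟧))

      wall-sides : ∀ a b k → ShiHyp m a b k → ¬ (a ≡ Fin.zero × b ≡ last × k ≡ + m) → WallSide a b k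
      wall-sides a b k (a<b , _ , k≤m) ¬θ = by-floor (rep-wall-floor a<b)
        where
        θ-sides : k ≢ + m → WallSide Fin.zero last k
        θ-sides k≢m = (λ m≡k → k≢m (sym (⟦⟧-injective (trans (sym wall-on-θ) m≡k)))) ,
          mk⇔ (λ wall<k → ⊥-elim (beyond-θ (ℚ.≤-reflexive (sym wall-on-θ)) k≤m wall<k))
              (λ rep<k → ⊥-elim (beyond-θ (ℚ.<⇒≤ (hasFloor-lower floor-first-last)) k≤m rep<k))

        by-floor : SharedFloor a b → WallSide a b k
        by-floor (d , rep-floor , inj₂ wall-floor) = hasFloor-≢⟦⟧ {k = k} wall-floor , hasFloor-sameSide k wall-floor rep-floor
        by-floor (d , _ , inj₁ (a≡0 , b≡last)) =
          subst₂ (λ a b → WallSide a b k) (sym a≡0) (sym b≡last) (θ-sides (λ k≡m → ¬θ (a≡0 , b≡last , k≡m)))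

      separates : Separates Fin.zero last rep Fin.zero last (+ m)
      separates x x∈A0 = inj₁ (A0-below-θ x∈A0 , hasFloor-lower floor-first-last)

  open Representative using (rep; σ)

  module _ {g g' : Fin K → Fin m} (same : SameRegion m (rep g) (rep g')) where
    private
      module A = Representative g
      module B = Representative g'
      floor≡ : ∀ {d d'} a b → a Fin.< b → HasFloor (pair (rep g) a b) (+ d) → HasFloor (pair (rep g') a b) (+ d') →
        d ℕ.< m → d' ℕ.< m → d ≡ d'
      floor≡ = sameRegion-floor≡ {v = rep g} {w = rep g'} same

    sameRegion-floorAt : ∀ j → A.floorAt j ≡ B.floorAt j
    sameRegion-floorAt j = floor≡ Fin.zero (mid j) (first<mid j)
      (A.floor-first-mid _ j) (B.floor-first-mid _ j) (A.floorAt<m j) (B.floorAt<m j)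

    -- The floor of pair rep (mid i) (mid j) tells whether σ increases from i to j.
    sameRegion-¬σ-flip : ∀ {i j} → i Fin.< j → σ g i Fin.< σ g j → ¬ σ g' j Fin.< σ g' i
    sameRegion-¬σ-flip {i} {j} i<j σi<σj σ'j<σ'i = ℕ.1+n≢n (begin
      suc (Gj ∸ suc Gi)  ≡⟨ ℕ.+-∸-assoc 1 Gi<Gj ⟨
      Gj ∸ Gi            ≡⟨ floor≡ (mid i) (mid j) (mid-mono i<j) (A.floor-mid-mid-< _ i<j σi<σj)
                              (subst₂ (λ x y → HasFloor _ (+ (x ∸ suc y))) (sym (sameRegion-floorAt j)) (sym (sameRegion-floorAt i))
                                (B.floor-mid-mid-> _ i<j σ'j<σ'i))
                              (ℕ.≤-<-trans (ℕ.m∸n≤m Gj Gi) (A.floorAt<m j)) (ℕ.≤-<-trans (ℕ.m∸n≤m Gj (suc Gi)) (A.floorAt<m j)) ⟩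
      Gj ∸ suc Gi        ∎)
      where
      open ≡-Reasoning
      Gi Gj : ℕ
      Gi = A.floorAt i
      Gj = A.floorAt j
      Gi<Gj : Gi ℕ.< Gj
      Gi<Gj = subst₂ ℕ._<_ (sym (sameRegion-floorAt i)) (sym (sameRegion-floorAt j)) (B.floorAt-monoˢ i<j σ'j<σ'i)

  sameRegion-σ-mono : ∀ {g g'} → SameRegion m (rep g) (rep g') → ∀ {i j} → σ g i Fin.< σ g j → σ g' i Fin.< σ g' j
  sameRegion-σ-mono {g} {g'} same {i} {j} σi<σj = by-σ' (Fin.<-cmp (σ g' i) (σ g' j))
    where
    ¬σ'-flip : σ g' j Fin.< σ g' i → Tri (i Fin.< j) (i ≡ j) (j Fin.< i) → σ g' i Fin.< σ g' j
    ¬σ'-flip σ'j<σ'i (tri< i<j _ _) = ⊥-elim (sameRegion-¬σ-flip same i<j σi<σj σ'j<σ'i)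
    ¬σ'-flip σ'j<σ'i (tri≈ _ refl _) = ⊥-elim (Fin.<-irrefl refl σi<σj)
    ¬σ'-flip σ'j<σ'i (tri> _ _ j<i) =
      ⊥-elim (sameRegion-¬σ-flip (sameRegion-sym {v = rep g} {w = rep g'} same) j<i σ'j<σ'i σi<σj)

    by-σ' : Tri (σ g' i Fin.< σ g' j) (σ g' i ≡ σ g' j) (σ g' j Fin.< σ g' i) → σ g' i Fin.< σ g' j
    by-σ' (tri< σ'i<σ'j _ _) = σ'i<σ'j
    by-σ' (tri≈ _ σ'i≡σ'j _) = ⊥-elim (Fin.<-irrefl (cong (σ g) (Representative.unrank-injective g' σ'i≡σ'j)) σi<σj)
    by-σ' (tri> _ _ σ'j<σ'i) = ¬σ'-flip σ'j<σ'i (Fin.<-cmp i j)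

  rep-injective : ∀ {g g'} → SameRegion m (rep g) (rep g') → ∀ r → g r ≡ g' r
  rep-injective {g} {g'} same r = Fin.toℕ-injective (begin
    toℕ (g r)                             ≡⟨ cong (toℕ ∘ g) (A.unrank-rank r) ⟨
    A.floorAt (A.rank r)                  ≡⟨ sameRegion-floorAt same (A.rank r) ⟩
    B.floorAt (A.rank r)                  ≡⟨ cong (toℕ ∘ g') (strictMono⇒≗id ψ ψ-mono r) ⟩
    toℕ (g' r)                            ∎)
    where
    open ≡-Reasoning
    module A = Representative g
    module B = Representative g'
    ψ : Fin K → Fin K
    ψ r = B.σ (A.rank r)
    ψ-mono : ∀ {r r'} → r Fin.< r' → ψ r Fin.< ψ r'
    ψ-mono {r} {r'} r<r' = sameRegion-σ-mono same (subst₂ Fin._<_ (sym (A.unrank-rank r)) (sym (A.unrank-rank r')) r<r')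

  module Cover {v : Pt n} (v-qualifies : Qualifies m Fin.zero last v) where

    v-off : OffArr m v
    v-off = proj₁ (proj₂ v-qualifies)

    v-dominant : Dominant v
    v-dominant = proj₁ (proj₂ (proj₂ v-qualifies))

    v-beyond-θ : ⟦ + m ⟧ ℚ.< pair v Fin.zero last
    v-beyond-θ = [ proj₂ , (λ (m<x , _) → ⊥-elim (ℚ.<-asym m<x (A0-below-θ A0-point∈A0))) ]′
      (proj₂ (proj₂ (proj₂ (proj₂ v-qualifies))) A0-point A0-point∈A0)

    private
      v-wall : IsWall m v Fin.zero last (+ m)
      v-wall = proj₁ (proj₂ (proj₂ (proj₂ v-qualifies)))

    -- a point of the facet of v's region on H_{θ,m}
    p : Pt n
    p = proj₁ (proj₂ v-wall)

    p-on-θ : pair p Fin.zero last ≡ ⟦ + m ⟧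
    p-on-θ = proj₁ (proj₂ (proj₂ (proj₂ v-wall)))

    p-sides : ∀ a b k → ShiHyp m a b k → ¬ (a ≡ Fin.zero × b ≡ last × k ≡ + m) →
      (pair p a b ≢ ⟦ k ⟧) × ((pair p a b ℚ.< ⟦ k ⟧) ⇔ (pair v a b ℚ.< ⟦ k ⟧))
    p-sides = proj₂ (proj₂ (proj₂ (proj₂ v-wall)))

    p-decreasing : ∀ {a b} → a Fin.< b → p b ℚ.< p a
    p-decreasing = consecutive⇒antitone p step
      where
      step : ∀ i j → toℕ j ≡ suc (toℕ i) → p j ℚ.< p i
      step i j j≡1+i = 0<q-p⇒p<q 0<p
        where
        level0 : ShiHyp m i j (+ 0)
        level0 = consecutive⇒< j≡1+i , shiLevel-zero m≥1
        0<v : 0ℚ ℚ.< pair v i j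
        0<v = ≤∧≢⇒< (0≤q-p (v-dominant i j j≡1+i)) (λ 0≡v → v-off i j (+ 0) level0 (sym 0≡v))
        p-level0 : (pair p i j ≢ 0ℚ) × ((pair p i j ℚ.< 0ℚ) ⇔ (pair v i j ℚ.< 0ℚ))
        p-level0 = p-sides i j (+ 0) level0 (λ (_ , _ , 0≡m) → ℕ.<⇒≢ m≥1 (ℤ.+-injective 0≡m))
        0<p : 0ℚ ℚ.< pair p i j
        0<p = ≤∧≢⇒< (ℚ.≮⇒≥ (λ p<0 → ℚ.<-asym 0<v (Equivalence.to (proj₂ p-level0) p<0))) (λ 0≡p → proj₁ p-level0 (sym 0≡p))

    0<pair-p : ∀ {a b} → a Fin.< b → 0ℚ ℚ.< pair p a b
    0<pair-p a<b = 0<q-p (p-decreasing a<b)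

    pair-p-off : ∀ {a b} → a Fin.< b → (a ≡ Fin.zero → b ≢ last) → pair p a b ℚ.< ⟦ + m ⟧ →
      ∀ k → pair p a b ≢ ⟦ k ⟧
    pair-p-off {a} {b} a<b ¬θ p<m k p≡k =
      proj₁ (p-sides a b k (a<b , ℤ.<-trans (proj₁ (shiLevel-zero m≥1)) 0<k , ℤ.<⇒≤ k<m) (λ (a≡0 , b≡last , _) → ¬θ a≡0 b≡last)) p≡k
      where
      0<k : + 0 ℤ.< k
      0<k = ⟦⟧-cancel-< {+ 0} {k} (subst (0ℚ ℚ.<_) p≡k (0<pair-p a<b))
      k<m : k ℤ.< + m
      k<m = ⟦⟧-cancel-< {k} {+ m} (subst (ℚ._< ⟦ + m ⟧) p≡k p<m)

    h : Fin K → ℚ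
    h i = pair p Fin.zero (mid i)

    pair-p-mid-mid : ∀ i j → pair p (mid i) (mid j) ≡ h j ℚ.- h i
    pair-p-mid-mid i j = pair-split p Fin.zero (mid i) (mid j)

    h<m : ∀ i → h i ℚ.< ⟦ + m ⟧
    h<m i = subst (h i ℚ.<_) p-on-θ (ℚ.+-monoʳ-< (p Fin.zero) (ℚ.neg-antimono-< (p-decreasing (mid<last i))))

    pair-p-mid-last : ∀ i → pair p (mid i) last ≡ ⟦ + m ⟧ ℚ.- h i
    pair-p-mid-last i = trans (pair-split p Fin.zero (mid i) last) (cong (ℚ._- h i) p-on-θ)

    h-mono : ∀ {i j} → i Fin.< j → h i ℚ.< h j
    h-mono {i} {j} i<j = 0<q-p⇒p<q (subst (0ℚ ℚ.<_) (pair-p-mid-mid i j) (0<pair-p (mid-mono i<j)))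

    opaque
      h-floor : ∀ i → Σ ℕ λ d → d ℕ.< m × HasFloor (h i) (+ d)
      h-floor i = hasFloor-exists m (h i) (0<pair-p (first<mid i)) (h<m i)
        (pair-p-off (first<mid i) (λ _ → mid≢last i) (h<m i))

    floorOf : Fin K → ℕ
    floorOf i = proj₁ (h-floor i)

    floorOf<m : ∀ i → floorOf i ℕ.< m
    floorOf<m i = proj₁ (proj₂ (h-floor i))

    h-hasFloor : ∀ i → HasFloor (h i) (+ floorOf i)
    h-hasFloor i = proj₂ (proj₂ (h-floor i))

    fractOf : Fin K → ℚ
    fractOf i = fract (h i) (+ floorOf i)

    -- Equal fractional parts would make pair p (mid i) (mid j) an integer strictly between 0 and m.
    fractOf-distinct : ∀ {i j} → i Fin.< j → fractOf i ≢ fractOf j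
    fractOf-distinct {i} {j} i<j fi≡fj =
      pair-p-off (mid-mono i<j) (λ ()) p<m (+ floorOf j ℤ.- + floorOf i) (trans (pair-p-mid-mid i j) integral)
      where
      open ℚ-Solver.+-*-Solver using (solve; _:+_; _:-_; _:=_)
      open ≡-Reasoning
      Fi Fj : ℚ
      Fi = ⟦ + floorOf i ⟧
      Fj = ⟦ + floorOf j ⟧
      p<m : pair p (mid i) (mid j) ℚ.< ⟦ + m ⟧
      p<m = subst (ℚ._< ⟦ + m ⟧) (sym (pair-p-mid-mid i j))
        (ℚ.<-trans (q-p<q (h j) (0<pair-p (first<mid i))) (h<m j))
      integral : h j ℚ.- h i ≡ ⟦ + floorOf j ℤ.- + floorOf i ⟧
      integral = begin
        h j ℚ.- h i                                  ≡⟨ solve 4 (λ a b A B → b :- a := (b :- B) :- (a :- A) :+ (B :- A)) refl (h i) (h j) Fi Fj ⟩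
        fractOf j ℚ.- fractOf i ℚ.+ (Fj ℚ.- Fi)      ≡⟨ cong (λ t → t ℚ.- fractOf i ℚ.+ (Fj ℚ.- Fi)) (sym fi≡fj) ⟩
        fractOf i ℚ.- fractOf i ℚ.+ (Fj ℚ.- Fi)      ≡⟨ cong (ℚ._+ (Fj ℚ.- Fi)) (ℚ.+-inverseʳ (fractOf i)) ⟩
        0ℚ ℚ.+ (Fj ℚ.- Fi)                           ≡⟨ ℚ.+-identityˡ _ ⟩
        Fj ℚ.- Fi                                    ≡⟨ ⟦⟧-homo-sub (+ floorOf j) (+ floorOf i) ⟨
        ⟦ + floorOf j ℤ.- + floorOf i ⟧              ∎

    fractOf-connex : ∀ i j → i ≢ j → fractOf i ℚ.< fractOf j ⊎ fractOf j ℚ.< fractOf i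
    fractOf-connex i j i≢j = by-fract (ℚ.<-cmp (fractOf i) (fractOf j))
      where
      by-index : fractOf i ≡ fractOf j → Tri (i Fin.< j) (i ≡ j) (j Fin.< i) → i ≡ j
      by-index fi≡fj (tri< i<j _ _) = ⊥-elim (fractOf-distinct i<j fi≡fj)
      by-index fi≡fj (tri≈ _ i≡j _) = i≡j
      by-index fi≡fj (tri> _ _ j<i) = ⊥-elim (fractOf-distinct j<i (sym fi≡fj))

      by-fract : Tri (fractOf i ℚ.< fractOf j) (fractOf i ≡ fractOf j) (fractOf j ℚ.< fractOf i) →
        fractOf i ℚ.< fractOf j ⊎ fractOf j ℚ.< fractOf i
      by-fract (tri< fi<fj _ _) = inj₁ fi<fj
      by-fract (tri≈ _ fi≡fj _) = ⊥-elim (i≢j (by-index fi≡fj (Fin.<-cmp i j)))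
      by-fract (tri> _ _ fj<fi) = inj₂ fj<fi

    open Ranking (λ i j → fractOf i ℚ.< fractOf j) (λ i j → fractOf i ℚ.<? fractOf j)
      (λ i → ℚ.<-irrefl refl) ℚ.<-trans fractOf-connex public

    code : Fin K → Fin m
    code r = Fin.fromℕ< (floorOf<m (unrank r))

    module _ (g : Fin K → Fin m) (g≗code : ∀ r → g r ≡ code r) where
      private
        module R = Representative g

      floorOf-rank : ∀ i → toℕ (g (rank i)) ≡ floorOf i
      floorOf-rank i = trans (cong toℕ (g≗code (rank i)))
        (trans (Fin.toℕ-fromℕ< (floorOf<m (unrank (rank i)))) (cong floorOf (unrank-rank i)))

      floorOf-mono : ∀ {i j} → i Fin.< j → floorOf i ℕ.≤ floorOf j
      floorOf-mono {i} {j} i<j = ℕ.≤-pred (ℤ.drop‿+<+ (hasFloor-<⟦⟧⇒< {k = + suc (floorOf j)} (h-hasFloor i)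
        (ℚ.<-trans (h-mono i<j) (hasFloor-upper (h-hasFloor j)))))

      rank-◁ : ∀ {i j} → i Fin.< j → rank i R.◁ rank j
      rank-◁ {i} {j} i<j = by-floors (ℕ.<-cmp (floorOf i) (floorOf j))
        where
        by-floors : Tri (floorOf i ℕ.< floorOf j) (floorOf i ≡ floorOf j) (floorOf j ℕ.< floorOf i) → rank i R.◁ rank j
        by-floors (tri< Fi<Fj _ _) = inj₁ (subst₂ ℕ._<_ (sym (floorOf-rank i)) (sym (floorOf-rank j)) Fi<Fj)
        by-floors (tri≈ _ Fi≡Fj _) = inj₂ (Fin.toℕ-injective (trans (floorOf-rank i) (trans Fi≡Fj (sym (floorOf-rank j)))) ,
          rank-mono (subst (λ F → fractOf i ℚ.< h j ℚ.- ⟦ + F ⟧) Fi≡Fj (ℚ.+-monoˡ-< (ℚ.- ⟦ + floorOf i ⟧) (h-mono i<j))))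
        by-floors (tri> _ _ Fj<Fi) = ⊥-elim (ℕ.<⇒≱ Fj<Fi (floorOf-mono i<j))

      σ≗rank : ∀ i → R.σ i ≡ rank i
      σ≗rank i = trans (cong R.σ (sym (strictMono⇒≗id (R.rank ∘ rank) (λ i<j → R.rank-mono (rank-◁ i<j)) i)))
                       (R.unrank-rank (rank i))

      floorAt≗floorOf : ∀ j → R.floorAt j ≡ floorOf j
      floorAt≗floorOf j = trans (cong (toℕ ∘ g) (σ≗rank j)) (floorOf-rank j)

      private
        through-p : ∀ {a b k d} → ShiHyp m a b k → ¬ (a ≡ Fin.zero × b ≡ last × k ≡ + m) →
          HasFloor (pair p a b) d → HasFloor (pair R.rep a b) d → (pair v a b ℚ.< ⟦ k ⟧) ⇔ (pair R.rep a b ℚ.< ⟦ k ⟧)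
        through-p {a} {b} {k} hyp ¬θ p-floor rep-floor =
          ⇔-trans (⇔-sym (proj₂ (p-sides a b k hyp ¬θ))) (hasFloor-sameSide k p-floor rep-floor)

        rep-floor : ∀ {a b d d'} → d ≡ d' → HasFloor (pair R.rep a b) (+ d) → HasFloor (pair R.rep a b) (+ d')
        rep-floor refl fl = fl

        mid-mid-sides : ∀ {i j k} → i Fin.< j → ShiHyp m (mid i) (mid j) k →
          Tri (R.σ i Fin.< R.σ j) (R.σ i ≡ R.σ j) (R.σ j Fin.< R.σ i) →
          (pair v (mid i) (mid j) ℚ.< ⟦ k ⟧) ⇔ (pair R.rep (mid i) (mid j) ℚ.< ⟦ k ⟧)
        mid-mid-sides {i} {j} i<j hyp (tri< σi<σj _ _) = through-p hyp (λ ())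
          (subst₂ HasFloor (sym (pair-p-mid-mid i j)) (+m-+n≡+[m∸n] (floorOf-mono i<j))
            (hasFloor-sub-< (h-hasFloor i) (h-hasFloor j) (rank-cancel (subst₂ Fin._<_ (σ≗rank i) (σ≗rank j) σi<σj))))
          (rep-floor (cong₂ _∸_ (floorAt≗floorOf j) (floorAt≗floorOf i)) (R.floor-mid-mid-< _ i<j σi<σj))
        mid-mid-sides i<j hyp (tri≈ _ σi≡σj _) = ⊥-elim (Fin.<-irrefl (R.unrank-injective σi≡σj) i<j)
        mid-mid-sides {i} {j} i<j hyp (tri> _ _ σj<σi) = through-p hyp (λ ())
          (subst₂ HasFloor (sym (pair-p-mid-mid i j)) (+m-+n-1≡+[m∸1+n] Fi<Fj)
            (hasFloor-sub-> (h-hasFloor i) (h-hasFloor j) (rank-cancel (subst₂ Fin._<_ (σ≗rank j) (σ≗rank i) σj<σi))))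
          (rep-floor (cong₂ (λ x y → x ∸ suc y) (floorAt≗floorOf j) (floorAt≗floorOf i)) (R.floor-mid-mid-> _ i<j σj<σi))
          where
          Fi<Fj : floorOf i ℕ.< floorOf j
          Fi<Fj = subst₂ ℕ._<_ (floorAt≗floorOf i) (floorAt≗floorOf j) (R.floorAt-monoˢ i<j σj<σi)

        sides : ∀ {a b k} → ShiHyp m a b k → OrderedPair a b → (pair v a b ℚ.< ⟦ k ⟧) ⇔ (pair R.rep a b ℚ.< ⟦ k ⟧)
        sides (_ , _ , k≤m) first-last =
          mk⇔ (λ v<k → ⊥-elim (beyond-θ (ℚ.<⇒≤ v-beyond-θ) k≤m v<k))
              (λ rep<k → ⊥-elim (beyond-θ (ℚ.<⇒≤ (hasFloor-lower R.floor-first-last)) k≤m rep<k))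
        sides hyp (first-mid j) = through-p hyp (λ (_ , mid≡last , _) → mid≢last j mid≡last) (h-hasFloor j)
          (rep-floor (floorAt≗floorOf j) (R.floor-first-mid _ j))
        sides hyp (mid-last i) = through-p hyp (λ ())
          (subst₂ HasFloor (sym (pair-p-mid-last i)) (+m-+n-1≡+[m∸1+n] (floorOf<m i)) (hasFloor-complement (+ m) (h-hasFloor i)))
          (rep-floor (cong (λ x → m ∸ suc x) (floorAt≗floorOf i)) (R.floor-mid-last ℕ.≤-refl i))
        sides hyp (mid-mid {i} {j} i<j) = mid-mid-sides i<j hyp (Fin.<-cmp (R.σ i) (R.σ j))

      covered : SameRegion m v R.rep
      covered a b k hyp = sides hyp (orderedPair (proj₁ hyp))

  regions : NumRegions≡ m Fin.zero last (m ^ K)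
  regions = List.tabulate (rep ∘ Fin.finToFun) , List.length-tabulate _ ,
    All.tabulate⁺ (λ i → Representative.rep-qualifies (Fin.finToFun i)) ,
    AllPairs.tabulate⁺ (λ i≢j same → i≢j (finToFun-injective (rep-injective same))) ,
    λ v v-qualifies → let open Cover v-qualifies in
      Any.tabulate⁺ (Fin.funToFin code) (covered (Fin.finToFun (Fin.funToFin code)) (Fin.finToFun-funToFin code))

corollary4p5 : (n m : ℕ) → 2 ≤ n → 1 ≤ m →
    (a0 b0 : Fin n) → toℕ a0 ≡ 0 → toℕ b0 ≡ n ∸ 1 →
    NumRegions≡ m a0 b0 (m ^ (n ∸ 2))
corollary4p5 zero m () m≥1 a0 b0 a0≡0 b0≡n-1
corollary4p5 (suc zero) m (s≤s ()) m≥1 a0 b0 a0≡0 b0≡n-1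
corollary4p5 (suc (suc K)) m _ m≥1 a0 b0 a0≡0 b0≡n-1
  rewrite Fin.toℕ-injective {i = a0} {j = Fin.zero} a0≡0
        | Fin.toℕ-injective {i = b0} {j = Layout.last K} (trans b0≡n-1 (sym (Layout.toℕ-last K)))
  = Regions.regions K m m≥1
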